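{- Let $n\ge3$ be an integer and let $r$ be a positive integer with $r\mid 2n-2$. Let $T=[C_n,\{f_{v_i}\}_{i=1}^n,\mathrm{id}]\colon\mathbb F_2^n\to\mathbb F_2^n$, where $f_{v_i}\in\{\mathrm{parity}_3,(1+\mathrm{parity})_3\}$ for all $i$. If $T$ has a fixed point, then \[|\mathrm{Per}_1(T^r)|=\begin{cases}2^{r+1}, & \text{if } r\mid n-1 \text{ and } n\equiv0\pmod 2;\\ 2^r, & \text{if } r\mid n-1\text{ and } n\equiv 1\pmod 2;\\ 2^{\frac r2+1}, & \text{if } r\nmid n-1.\end{cases}\] If $T$ does not have a fixed point, then \[|\mathrm{Per}_1(T^r)|=\begin{cases}0, & \text{if } r\mid n-1;\\ 2^{\frac r2+1}, & \text{if } r\nmid n-1.\end{cases}\]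
   Context: $C_n$ is the cycle graph with vertices $v_1,\dots,v_n$, $v_i$ adjacent to $v_j$ iff $i-j\equiv\pm1\pmod n$. $\mathrm{parity}_3(x,y,z)=x+y+z$ and $(1+\mathrm{parity})_3(x,y,z)=1+x+y+z$ over $\mathbb F_2$. For $x=(x_1,\dots,x_n)\in\mathbb F_2^n$, the local update $F_{v_i}$ replaces $x_i$ by $f_{v_i}(x_{i-1},x_i,x_{i+1})$ (indices mod $n$) and leaves the other coordinates unchanged; the SDS map with identity update order is $T=[C_n,\{f_{v_i}\},\mathrm{id}]=F_{v_n}\circ\cdots\circ F_{v_1}$. $\mathrm{Per}_1(f)$ denotes the set of fixed points of a map $f$. -}

module Defs where

open import Data.Bool using (Bool; true; false; if_then_else_; not; _xor_)
open import Data.Nat using (ℕ; zero; suc; _+_; _∸_; _≡ᵇ_; _%_)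
open import Data.Nat.DivMod using (m%n<n)
open import Data.Fin using (Fin; toℕ; fromℕ<)
open import Data.Vec using (Vec; []; _∷_; lookup; tabulate)
open import Data.Vec.Properties using (≡-dec)
open import Data.List using (List; []; _∷_; map; _++_; length; filter)
open import Data.Product using (∃)
open import Relation.Binary.PropositionalEquality using (_≡_)
open import Relation.Nullary using (Dec)
import Data.Bool as B

data LocalFn : Set where
  parity₃    : LocalFn
  1+parity₃  : LocalFn

eval : LocalFn → Bool → Bool → Bool → Bool
eval parity₃   x y z = x xor y xor z
eval 1+parity₃ x y z = not (x xor y xor z)

-- State x ∈ F_2^n ; coordinate x_{k+1} is  lookup x (k) , i.e. 0-based.
State : ℕ → Set
State n = Vec Bool n

at : ∀ {n} → State n → ℕ → Bool
at {zero}  x k = false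
at {suc m} x k = lookup x (fromℕ< (m%n<n k (suc m)))

fnAt : ∀ {n} → Vec LocalFn n → ℕ → LocalFn
fnAt {zero}  fs k = parity₃
fnAt {suc m} fs k = lookup fs (fromℕ< (m%n<n k (suc m)))

-- Local update F_{v_{i+1}} (0-based i) on C_n: neighbours i-1, i+1 mod n.
localUpdate : ∀ {n} → Vec LocalFn n → ℕ → State n → State n
localUpdate {n} fs i x =
  tabulate λ j → if toℕ j ≡ᵇ i
                   then eval (fnAt fs i) (at x (i + (n ∸ 1))) (at x i) (at x (i + 1))
                   else lookup x j

sweep : ∀ {n} → Vec LocalFn n → ℕ → State n → State n
sweep fs zero    x = x
sweep fs (suc k) x = localUpdate fs k (sweep fs k x)

SDS : ∀ {n} → Vec LocalFn n → State n → State n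
SDS {n} fs = sweep fs n

iter : ∀ {A : Set} → ℕ → (A → A) → A → A
iter zero    f a = a
iter (suc k) f a = f (iter k f a)

allStates : (n : ℕ) → List (State n)
allStates zero    = [] ∷ []
allStates (suc n) = map (false ∷_) (allStates n) ++ map (true ∷_) (allStates n)

numFixed : ∀ {n} → (State n → State n) → ℕ
numFixed {n} g = length (filter (λ x → ≡-dec B._≟_ (g x) x) (allStates n))

HasFixedPoint : ∀ {n} → (State n → State n) → Set
HasFixedPoint {n} g = ∃ λ (x : State n) → g x ≡ x

-- Over F₂ the sweep T is affine. In the coordinates S x = x₀ + x_{n-1} and
-- Z_j x = x_{j+1} + [j odd] S x + h_j (j < n - 1) it acts as s ↦ s + β together with the shift
-- register z ↦ (z₁, …, z_{n-2}, z₀ + τ s + K), where τ = [n odd]. So x is determined by S x and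
-- the stream w_t = Z₀(Tᵗ x), which obeys w_{t+n-1} = w_t + τ (S x + β [t odd]) + K, and x is
-- fixed by Tʳ iff β [r odd] = 0 and w is r-periodic. If r ∣ n - 1, periodicity forces β = 0 and
-- τ s + K = 0: the r-periodic streams give 2ʳ fixed points for the one admissible s = K when n
-- is odd, 2^{r+1} when n is even, and none when T has no fixed point. Otherwise r = 2q with
-- n - 1 an odd multiple of q, and the fixed streams are exactly the solutions of
-- w_{t+q} = w_t + τ (s + β [t odd]) + K, one for each s and each initial block: 2^{q+1}.

module Submission where

open import Defs
open import Data.Nat using (ℕ; _≤_; _∸_; _*_; _^_; _+_; _/_; _%_)
open import Data.Nat.Divisibility using (_∣_)
open import Data.Vec using (Vec)
open import Data.Product using (_×_)
open import Relation.Nullary using (¬_)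
open import Relation.Binary.PropositionalEquality using (_≡_)

open import Algebra.Solver.Ring.AlmostCommutativeRing using (fromCommutativeRing)
import Algebra.Solver.Ring.Simple as RingSolver
open import Data.Bool using (Bool; true; false; not; _xor_; _∧_; if_then_else_)
import Data.Bool.Properties as Bool
open import Data.Empty using (⊥-elim)
open import Data.Fin using (Fin; toℕ; fromℕ<)
open import Data.Fin.Properties using (toℕ-injective; toℕ-fromℕ<; toℕ<n)
open import Data.List using (List; []; _∷_; _++_; map; length; filter)
open import Data.List.Properties using (length-++; length-map; filter-none)
open import Data.List.Relation.Unary.All using (universal)
open import Data.Nat using (zero; suc; _<_; _≡ᵇ_; z≤n; s≤s; NonZero)
open import Data.Nat.DivMod
  using (m%n<n; m<n⇒m%n≡m; [m+n]%n≡m%n; m<n⇒m/n≡0; m/n≡1+[m∸n]/n; m≡m%n+[m/n]*n; m*n/n≡m)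
open import Data.Nat.Divisibility using (divides)
open import Data.Nat.Properties
  using (≤-refl; ≤-trans; n≤1+n; <⇒≤; <⇒≢; >⇒≢; ≡ᵇ⇒≡; ≡⇒≡ᵇ; m<1+n⇒m<n∨m≡n; m≤n+m; m+n∸n≡m;
         +-assoc; +-comm; +-identityʳ; +-suc; *-comm; *-identityʳ; *-distribʳ-+; *-cancelˡ-≡;
         +-commutativeSemigroup)
open import Algebra.Properties.CommutativeSemigroup +-commutativeSemigroup
  using () renaming (interchange to +-interchange)
open import Data.Nat.Tactic.RingSolver using (solve-∀)
open import Data.Product using (_,_; proj₁; proj₂; Σ)
open import Data.Sum using (_⊎_; inj₁; inj₂)
open import Data.Unit using (tt)
open import Data.Vec using ([]; _∷_; lookup; tabulate)
open import Data.Vec.Properties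
  using (≡-dec; ∷-injectiveˡ; ∷-injectiveʳ; lookup∘tabulate; tabulate∘lookup; tabulate-cong)
open import Relation.Nullary using (Dec; yes; no)
open import Relation.Binary.PropositionalEquality using (refl; sym; trans; cong; cong₂; subst; module ≡-Reasoning)

∑ : {A : Set} → (A → ℕ) → List A → ℕ
∑ f []       = 0
∑ f (x ∷ xs) = f x + ∑ f xs

∑-++ : {A : Set} (f : A → ℕ) (xs ys : List A) → ∑ f (xs ++ ys) ≡ ∑ f xs + ∑ f ys
∑-++ f []       ys = refl
∑-++ f (x ∷ xs) ys = trans (cong (f x +_) (∑-++ f xs ys)) (sym (+-assoc (f x) _ _))

∑-map : {A B : Set} (f : B → ℕ) (g : A → B) (xs : List A) → ∑ f (map g xs) ≡ ∑ (λ x → f (g x)) xs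
∑-map f g []       = refl
∑-map f g (x ∷ xs) = cong (f (g x) +_) (∑-map f g xs)

∑-cong : {A : Set} {f g : A → ℕ} → (∀ x → f x ≡ g x) → (xs : List A) → ∑ f xs ≡ ∑ g xs
∑-cong f≗g []       = refl
∑-cong f≗g (x ∷ xs) = cong₂ _+_ (f≗g x) (∑-cong f≗g xs)

∑-+ : {A : Set} (f g : A → ℕ) (xs : List A) → ∑ (λ x → f x + g x) xs ≡ ∑ f xs + ∑ g xs
∑-+ f g []       = refl
∑-+ f g (x ∷ xs) = trans (cong (f x + g x +_) (∑-+ f g xs)) (+-interchange (f x) (g x) (∑ f xs) (∑ g xs))

∑-zero : {A : Set} (xs : List A) → ∑ (λ _ → 0) xs ≡ 0
∑-zero []       = refl
∑-zero (x ∷ xs) = ∑-zero xs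

∑-comm : {A B : Set} (f : A → B → ℕ) (xs : List A) (ys : List B) →
         ∑ (λ x → ∑ (f x) ys) xs ≡ ∑ (λ y → ∑ (λ x → f x y) xs) ys
∑-comm f []       ys = sym (∑-zero ys)
∑-comm f (x ∷ xs) ys = trans (cong (∑ (f x) ys +_) (∑-comm f xs ys))
                             (sym (∑-+ (f x) (λ y → ∑ (λ x' → f x' y) xs) ys))

∑-one : {A : Set} (xs : List A) → ∑ (λ _ → 1) xs ≡ length xs
∑-one []       = refl
∑-one (x ∷ xs) = cong suc (∑-one xs)

indicator : {P : Set} → Dec P → ℕ
indicator (yes _) = 1
indicator (no _)  = 0

indicator-yes : {P : Set} → P → (p : Dec P) → indicator p ≡ 1
indicator-yes p (yes _) = refl
indicator-yes p (no ¬p) = ⊥-elim (¬p p)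

indicator-no : {P : Set} → ¬ P → (p : Dec P) → indicator p ≡ 0
indicator-no ¬p (yes p) = ⊥-elim (¬p p)
indicator-no ¬p (no _)  = refl

indicator-cong : {P Q : Set} → (P → Q) → (Q → P) → (p : Dec P) (q : Dec Q) → indicator p ≡ indicator q
indicator-cong P⇒Q Q⇒P (yes p) q = sym (indicator-yes (P⇒Q p) q)
indicator-cong P⇒Q Q⇒P (no ¬p) q = sym (indicator-no (λ q → ¬p (Q⇒P q)) q)

length-filter : {A : Set} {P : A → Set} (P? : ∀ x → Dec (P x)) (xs : List A) →
                length (filter P? xs) ≡ ∑ (λ x → indicator (P? x)) xs
length-filter P? []       = refl
length-filter P? (x ∷ xs) with P? x
... | yes _ = cong suc (length-filter P? xs)
... | no _  = length-filter P? xs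

_≟ₛ_ : ∀ {n} (x y : State n) → Dec (x ≡ y)
_≟ₛ_ = ≡-dec Bool._≟_

length-allStates : ∀ n → length (allStates n) ≡ 2 ^ n
length-allStates zero    = refl
length-allStates (suc n) = begin
  length (map (false ∷_) (allStates n) ++ map (true ∷_) (allStates n))
    ≡⟨ length-++ (map (false ∷_) (allStates n)) ⟩
  length (map (false ∷_) (allStates n)) + length (map (true ∷_) (allStates n))
    ≡⟨ cong₂ _+_ (length-map _ (allStates n)) (length-map _ (allStates n)) ⟩
  length (allStates n) + length (allStates n)
    ≡⟨ cong₂ _+_ (length-allStates n) (trans (length-allStates n) (sym (+-identityʳ _))) ⟩
  2 ^ n + (2 ^ n + 0) ∎
  where open ≡-Reasoning

∑-allStates-≟ : ∀ {n} (x : State n) → ∑ (λ y → indicator (x ≟ₛ y)) (allStates n) ≡ 1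
∑-allStates-≟ {zero}  []      = refl
∑-allStates-≟ {suc n} (b ∷ x) = begin
  ∑ count (map (false ∷_) xs ++ map (true ∷_) xs)
    ≡⟨ ∑-++ count (map (false ∷_) xs) (map (true ∷_) xs) ⟩
  ∑ count (map (false ∷_) xs) + ∑ count (map (true ∷_) xs)
    ≡⟨ cong₂ _+_ (∑-map count (false ∷_) xs) (∑-map count (true ∷_) xs) ⟩
  ∑ (λ y → count (false ∷ y)) xs + ∑ (λ y → count (true ∷ y)) xs
    ≡⟨ split b ⟩
  1 ∎
  where
  open ≡-Reasoning
  xs : List (State n)
  xs = allStates n
  count : State (suc n) → ℕ
  count y = indicator ((b ∷ x) ≟ₛ y)
  hit : ∀ c → ∑ (λ y → indicator ((c ∷ x) ≟ₛ (c ∷ y))) xs ≡ 1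
  hit c = trans (∑-cong (λ y → indicator-cong ∷-injectiveʳ (cong (c ∷_)) _ (x ≟ₛ y)) xs)
                (∑-allStates-≟ x)
  miss : ∀ c d → ¬ c ≡ d → ∑ (λ y → indicator ((c ∷ x) ≟ₛ (d ∷ y))) xs ≡ 0
  miss c d c≢d = trans (∑-cong (λ y → indicator-no (λ eq → c≢d (∷-injectiveˡ eq)) _) xs)
                       (∑-zero xs)
  split : ∀ c → ∑ (λ y → indicator ((c ∷ x) ≟ₛ (false ∷ y))) xs
              + ∑ (λ y → indicator ((c ∷ x) ≟ₛ (true ∷ y))) xs ≡ 1
  split false = cong₂ _+_ (hit false) (miss false true λ ())
  split true  = cong₂ _+_ (miss true false λ ()) (hit true)

numFixed-≡-0 : ∀ {n} (g : State n → State n) → (∀ x → ¬ g x ≡ x) → numFixed g ≡ 0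
numFixed-≡-0 {n} g no-fix =
  cong length (filter-none (λ x → g x ≟ₛ x) (universal no-fix (allStates n)))

numFixed-≡-2^ : ∀ {n k} (g : State n → State n) (to : State k → State n) (from : State n → State k) →
                (∀ z → g (to z) ≡ to z) → (∀ z → from (to z) ≡ z) → (∀ x → g x ≡ x → to (from x) ≡ x) →
                numFixed g ≡ 2 ^ k
numFixed-≡-2^ {n} {k} g to from to-fixed from∘to to∘from = begin
  numFixed g                                                  ≡⟨ length-filter (λ x → g x ≟ₛ x) (allStates n) ⟩
  ∑ (λ x → indicator (g x ≟ₛ x)) (allStates n)                ≡⟨ ∑-cong fixed-count (allStates n) ⟩
  ∑ (λ x → ∑ (λ z → indicator (x ≟ₛ to z)) (allStates k)) (allStates n)
    ≡⟨ ∑-comm (λ x z → indicator (x ≟ₛ to z)) (allStates n) (allStates k) ⟩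
  ∑ (λ z → ∑ (λ x → indicator (x ≟ₛ to z)) (allStates n)) (allStates k)
    ≡⟨ ∑-cong preimage-count (allStates k) ⟩
  ∑ (λ _ → 1) (allStates k)                                   ≡⟨ ∑-one (allStates k) ⟩
  length (allStates k)                                        ≡⟨ length-allStates k ⟩
  2 ^ k                                                       ∎
  where
  open ≡-Reasoning
  preimage-count : ∀ z → ∑ (λ x → indicator (x ≟ₛ to z)) (allStates n) ≡ 1
  preimage-count z = trans (∑-cong (λ x → indicator-cong sym sym (x ≟ₛ to z) _) (allStates n))
                           (∑-allStates-≟ (to z))
  fixed-count : ∀ x → indicator (g x ≟ₛ x) ≡ ∑ (λ z → indicator (x ≟ₛ to z)) (allStates k)
  fixed-count x with g x ≟ₛ x
  ... | yes gx≡x = sym (trans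
        (∑-cong (λ z → indicator-cong (λ x≡tz → trans (cong from x≡tz) (from∘to z))
                                      (λ fx≡z → trans (sym (to∘from x gx≡x)) (cong to fx≡z))
                                      (x ≟ₛ to z) (from x ≟ₛ z)) (allStates k))
        (∑-allStates-≟ (from x)))
  ... | no gx≢x = sym (trans
        (∑-cong (λ z → indicator-no (λ x≡tz → gx≢x (trans (cong g x≡tz) (trans (to-fixed z) (sym x≡tz))))
                                    (x ≟ₛ to z)) (allStates k))
        (∑-zero (allStates k)))

-- The ring solver for (Bool, xor, ∧) with Bool itself as coefficient ring, so x xor x = false is known to it.
open RingSolver (fromCommutativeRing Bool.xor-∧-commutativeRing) Bool._≟_ using (solve; _:+_; _:*_; _:=_; con)

xor-≡-self⇒false : ∀ a c → a xor c ≡ a → c ≡ false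
xor-≡-self⇒false a c eq = begin
  c               ≡⟨ solve 2 (λ a c → c := (a :+ c) :+ a) refl a c ⟩
  (a xor c) xor a ≡⟨ cong (_xor a) eq ⟩
  a xor a         ≡⟨ Bool.xor-same a ⟩
  false           ∎
  where open ≡-Reasoning

xor-≡-false⇒≡ : ∀ a c → a xor c ≡ false → a ≡ c
xor-≡-false⇒≡ a c eq = begin
  a               ≡⟨ solve 2 (λ a c → a := (a :+ c) :+ c) refl a c ⟩
  (a xor c) xor c ≡⟨ cong (_xor c) eq ⟩
  c               ∎
  where open ≡-Reasoning

odd : ℕ → Bool
odd zero    = false
odd (suc n) = not (odd n)

odd-+ : ∀ m n → odd (m + n) ≡ odd m xor odd n
odd-+ zero    n = refl
odd-+ (suc m) n = trans (cong not (odd-+ m n)) (Bool.not-distribˡ-xor (odd m) (odd n))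

odd-* : ∀ m n → odd (m * n) ≡ odd m ∧ odd n
odd-* zero    n = refl
odd-* (suc m) n = begin
  odd (n + m * n)           ≡⟨ odd-+ n (m * n) ⟩
  odd n xor odd (m * n)     ≡⟨ cong (odd n xor_) (odd-* m n) ⟩
  odd n xor (odd m ∧ odd n) ≡⟨ solve 2 (λ a b → b :+ (a :* b) := (con true :+ a) :* b) refl (odd m) (odd n) ⟩
  not (odd m) ∧ odd n       ∎
  where open ≡-Reasoning

odd-double : ∀ n → odd (n + n) ≡ false
odd-double n = trans (odd-+ n n) (Bool.xor-same (odd n))

odd-+-*-double : ∀ a d b → odd (a + d * (b + b)) ≡ odd a
odd-+-*-double a d b = begin
  odd (a + d * (b + b))            ≡⟨ odd-+ a (d * (b + b)) ⟩
  odd a xor odd (d * (b + b))      ≡⟨ cong (odd a xor_) (trans (odd-* d (b + b)) (cong (odd d ∧_) (odd-double b))) ⟩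
  odd a xor (odd d ∧ false)        ≡⟨ cong (odd a xor_) (Bool.∧-zeroʳ (odd d)) ⟩
  odd a xor false                  ≡⟨ Bool.xor-identityʳ (odd a) ⟩
  odd a                            ∎
  where open ≡-Reasoning

odd-from-%2 : ∀ n {b} → n % 2 ≡ (if b then 1 else 0) → odd n ≡ b
odd-from-%2 zero          {false} _  = refl
odd-from-%2 (suc zero)    {true}  _  = refl
odd-from-%2 (suc (suc n))         eq = trans (Bool.not-involutive (odd n))
  (odd-from-%2 n (trans (sym (trans (cong (_% 2) (+-comm 2 n)) ([m+n]%n≡m%n n 2))) eq))

[n+n]/2≡n : ∀ n → (n + n) / 2 ≡ n
[n+n]/2≡n n = trans (cong (_/ 2) (trans (cong (n +_) (sym (+-identityʳ n))) (*-comm 2 n))) (m*n/n≡m n 2)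

2*[1+m]∸2≡m+m : ∀ m → 2 * suc m ∸ 2 ≡ m + m
2*[1+m]∸2≡m+m m = trans (cong (_∸ 1) (+-suc m (m + 0))) (cong (m +_) (+-identityʳ m))

even-or-odd : ∀ c → Σ ℕ λ d → c ≡ d + d ⊎ c ≡ suc (d + d)
even-or-odd zero    = 0 , inj₁ refl
even-or-odd (suc c) with even-or-odd c
... | d , inj₁ c≡d+d   = d , inj₂ (cong suc c≡d+d)
... | d , inj₂ c≡1+d+d = suc d , inj₁ (cong suc (trans c≡1+d+d (sym (+-suc d d))))

double-injective : ∀ {a b} → a + a ≡ b + b → a ≡ b
double-injective {a} {b} a+a≡b+b = *-cancelˡ-≡ a b 2
  (trans (cong (a +_) (+-identityʳ a)) (trans a+a≡b+b (sym (cong (b +_) (+-identityʳ b)))))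

-- r ∣ 2m with r ∤ m forces an odd cofactor, hence an even r = 2q with m an odd multiple of q.
halve-divisor : ∀ {m r} → r ∣ m + m → ¬ r ∣ m → Σ ℕ λ q → Σ ℕ λ d → r ≡ q + q × m ≡ q + d * r
halve-divisor {m} {r} (divides c m+m≡c*r) r∤m with even-or-odd c
... | d , inj₁ c≡d+d =
  ⊥-elim (r∤m (divides d (double-injective (trans m+m≡c*r (trans (cong (_* r) c≡d+d) (*-distribʳ-+ r d d))))))
... | d , inj₂ c≡1+d+d with even-or-odd r
...   | q , inj₁ r≡q+q = q , d , r≡q+q , double-injective (begin
        m + m                                   ≡⟨ m+m≡c*r ⟩
        c * r                                   ≡⟨ cong₂ _*_ c≡1+d+d r≡q+q ⟩
        suc (d + d) * (q + q)                   ≡⟨ distrib q d ⟩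
        (q + d * (q + q)) + (q + d * (q + q))   ≡⟨ cong (λ r → (q + d * r) + (q + d * r)) r≡q+q ⟨
        (q + d * r) + (q + d * r)               ∎)
  where
  open ≡-Reasoning
  distrib : ∀ q d → suc (d + d) * (q + q) ≡ (q + d * (q + q)) + (q + d * (q + q))
  distrib = solve-∀
...   | q , inj₂ r≡1+q+q = ⊥-elim (false≢true (begin
        false                    ≡⟨ odd-double m ⟨
        odd (m + m)              ≡⟨ cong odd m+m≡c*r ⟩
        odd (c * r)              ≡⟨ odd-* c r ⟩
        odd c ∧ odd r            ≡⟨ cong₂ _∧_ (trans (cong odd c≡1+d+d) (cong not (odd-double d)))
                                              (trans (cong odd r≡1+q+q) (cong not (odd-double q))) ⟩
        true                     ∎))
  where
  open ≡-Reasoning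
  false≢true : ¬ false ≡ true
  false≢true ()

iter-+ : ∀ {A : Set} (f : A → A) t r a → iter (t + r) f a ≡ iter t f (iter r f a)
iter-+ f zero    r a = refl
iter-+ f (suc t) r a = cong f (iter-+ f t r a)

Periodic : ℕ → (ℕ → Bool) → Set
Periodic r w = ∀ t → w (t + r) ≡ w t

periodic-* : ∀ {r w} → Periodic r w → ∀ c → Periodic (c * r) w
periodic-* {r} {w} w-per zero    t = cong w (+-identityʳ t)
periodic-* {r} {w} w-per (suc c) t = begin
  w (t + (r + c * r)) ≡⟨ cong w (trans (cong (t +_) (+-comm r (c * r))) (sym (+-assoc t (c * r) r))) ⟩
  w (t + c * r + r)   ≡⟨ w-per (t + c * r) ⟩
  w (t + c * r)       ≡⟨ periodic-* w-per c t ⟩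
  w t                 ∎
  where open ≡-Reasoning

IsSolution : ℕ → (ℕ → Bool) → (ℕ → Bool) → Set
IsSolution q e w = ∀ t → w (t + q) ≡ w t xor e t

periodic-double : ∀ {q w} → Periodic q w → Periodic (q + q) w
periodic-double {q} {w} w-per t = trans (cong w (sym (+-assoc t q q))) (trans (w-per (t + q)) (w-per t))

solution-periodic : ∀ {q e w} → IsSolution q e w → Periodic q e → Periodic (q + q) w
solution-periodic {q} {e} {w} w-sol e-per t = begin
  w (t + (q + q))             ≡⟨ cong w (sym (+-assoc t q q)) ⟩
  w (t + q + q)               ≡⟨ w-sol (t + q) ⟩
  w (t + q) xor e (t + q)     ≡⟨ cong₂ _xor_ (w-sol t) (e-per t) ⟩
  (w t xor e t) xor e t       ≡⟨ solve 2 (λ a c → (a :+ c) :+ c := a) refl (w t) (e t) ⟩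
  w t                         ∎
  where open ≡-Reasoning

module _ (q : ℕ) .{{_ : NonZero q}} (e : ℕ → Bool) where

  -- accumulate p j c is the value at j + c * q of the solution with initial values p.
  accumulate : (ℕ → Bool) → ℕ → ℕ → Bool
  accumulate p j zero    = p j
  accumulate p j (suc c) = accumulate p j c xor e (j + c * q)

  solution : (ℕ → Bool) → ℕ → Bool
  solution p t = accumulate p (t % q) (t / q)

  solution-init : ∀ p t → t < q → solution p t ≡ p t
  solution-init p t t<q = cong₂ (accumulate p) (m<n⇒m%n≡m t<q) (m<n⇒m/n≡0 t<q)

  solution-isSolution : ∀ p → IsSolution q e (solution p)
  solution-isSolution p t = begin
    accumulate p ((t + q) % q) ((t + q) / q)  ≡⟨ cong₂ (accumulate p) ([m+n]%n≡m%n t q) [t+q]/q≡1+t/q ⟩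
    accumulate p (t % q) (suc (t / q))        ≡⟨ cong (λ t′ → solution p t xor e t′) (sym (m≡m%n+[m/n]*n t q)) ⟩
    solution p t xor e t                      ∎
    where
    open ≡-Reasoning
    [t+q]/q≡1+t/q : (t + q) / q ≡ suc (t / q)
    [t+q]/q≡1+t/q = trans (m/n≡1+[m∸n]/n (m≤n+m q t)) (cong (λ t′ → suc (t′ / q)) (m+n∸n≡m t q))

  solution-unique : ∀ {u v} → IsSolution q e u → IsSolution q e v → (∀ j → j < q → u j ≡ v j) → ∀ t → u t ≡ v t
  solution-unique {u} {v} u-sol v-sol u≗v t = begin
    u t                                    ≡⟨ cong u t≡ ⟩
    u (t % q + (t / q) * q)                ≡⟨ accumulated u-sol (t % q) (t / q) ⟩
    accumulate u (t % q) (t / q)           ≡⟨ accumulate-cong (t / q) ⟩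
    accumulate v (t % q) (t / q)           ≡⟨ accumulated v-sol (t % q) (t / q) ⟨
    v (t % q + (t / q) * q)                ≡⟨ cong v t≡ ⟨
    v t                                    ∎
    where
    open ≡-Reasoning
    t≡ : t ≡ t % q + (t / q) * q
    t≡ = m≡m%n+[m/n]*n t q
    accumulated : ∀ {w} → IsSolution q e w → ∀ j c → w (j + c * q) ≡ accumulate w j c
    accumulated {w} w-sol j zero    = cong w (+-identityʳ j)
    accumulated {w} w-sol j (suc c) = begin
      w (j + (q + c * q))             ≡⟨ cong w (trans (cong (j +_) (+-comm q (c * q))) (sym (+-assoc j (c * q) q))) ⟩
      w (j + c * q + q)               ≡⟨ w-sol (j + c * q) ⟩
      w (j + c * q) xor e (j + c * q) ≡⟨ cong (_xor e (j + c * q)) (accumulated w-sol j c) ⟩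
      accumulate w j (suc c)          ∎
    accumulate-cong : ∀ c → accumulate u (t % q) c ≡ accumulate v (t % q) c
    accumulate-cong zero    = u≗v (t % q) (m%n<n t q)
    accumulate-cong (suc c) = cong (_xor e (t % q + c * q)) (accumulate-cong c)

at-lookup : ∀ {m} (x : State (suc m)) (i : Fin (suc m)) → at x (toℕ i) ≡ lookup x i
at-lookup x i = cong (lookup x) (toℕ-injective (trans (toℕ-fromℕ< _) (m<n⇒m%n≡m (toℕ<n i))))

at-periodic : ∀ {m} (x : State (suc m)) i → at x (i + suc m) ≡ at x i
at-periodic {m} x i = cong (lookup x) (toℕ-injective
  (trans (toℕ-fromℕ< _) (trans ([m+n]%n≡m%n i (suc m)) (sym (toℕ-fromℕ< _)))))

at-injective : ∀ {m} {x y : State (suc m)} → (∀ i → i < suc m → at x i ≡ at y i) → x ≡ y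
at-injective {x = x} {y} x≗y = begin
  x                      ≡⟨ tabulate∘lookup x ⟨
  tabulate (lookup x)    ≡⟨ tabulate-cong (λ i → trans (sym (at-lookup x i))
                                                 (trans (x≗y (toℕ i) (toℕ<n i)) (at-lookup y i))) ⟩
  tabulate (lookup y)    ≡⟨ tabulate∘lookup y ⟩
  y                      ∎
  where open ≡-Reasoning

at-tabulate : ∀ {m} (g : ℕ → Bool) i → i < suc m → at {suc m} (tabulate (λ j → g (toℕ j))) i ≡ g i
at-tabulate {m} g i i<n = trans (lookup∘tabulate (λ j → g (toℕ j)) (fromℕ< (m%n<n i (suc m))))
                                (cong g (trans (toℕ-fromℕ< _) (m<n⇒m%n≡m i<n)))

module _ {m} (fs : Vec LocalFn (suc m)) (i : ℕ) (x : State (suc m)) where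

  updatedValue : Bool
  updatedValue = eval (fnAt fs i) (at x (i + m)) (at x i) (at x (i + 1))

  at-localUpdate : ∀ j → j < suc m → at (localUpdate fs i x) j ≡ (if j ≡ᵇ i then updatedValue else at x j)
  at-localUpdate j j<n = trans
    (lookup∘tabulate (λ k → if toℕ k ≡ᵇ i then updatedValue else lookup x k) (fromℕ< (m%n<n j (suc m))))
    (cong (λ j′ → if j′ ≡ᵇ i then updatedValue else at x j) (trans (toℕ-fromℕ< _) (m<n⇒m%n≡m j<n)))

  at-localUpdate-≡ : i < suc m → at (localUpdate fs i x) i ≡ updatedValue
  at-localUpdate-≡ i<n with i ≡ᵇ i in eq | at-localUpdate i i<n
  ... | true  | eq′ = eq′
  ... | false | _   = ⊥-elim (subst Data.Bool.T eq (≡⇒≡ᵇ i i refl))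

  at-localUpdate-≢ : ∀ j → j < suc m → ¬ j ≡ i → at (localUpdate fs i x) j ≡ at x j
  at-localUpdate-≢ j j<n j≢i with j ≡ᵇ i in eq | at-localUpdate j j<n
  ... | true  | _   = ⊥-elim (j≢i (≡ᵇ⇒≡ j i (subst Data.Bool.T (sym eq) tt)))
  ... | false | eq′ = eq′

bit : LocalFn → Bool
bit parity₃   = false
bit 1+parity₃ = true

eval-≡-bit-xor : ∀ f a c d → eval f a c d ≡ bit f xor (a xor (c xor d))
eval-≡-bit-xor parity₃   a c d = refl
eval-≡-bit-xor 1+parity₃ a c d = refl

module Sweep {m} (fs : Vec LocalFn (suc m)) where

  b : ℕ → Bool
  b i = bit (fnAt fs i)

  B : ℕ → Bool
  B zero    = b 0
  B (suc j) = B j xor b (suc j)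

  S : State (suc m) → Bool
  S x = at x 0 xor at x m

  sweep-unchanged : ∀ x k j → k ≤ j → j < suc m → at (sweep fs k x) j ≡ at x j
  sweep-unchanged x zero    j _   _   = refl
  sweep-unchanged x (suc k) j k<j j<n =
    trans (at-localUpdate-≢ fs k (sweep fs k x) j j<n (>⇒≢ k<j)) (sweep-unchanged x k j (<⇒≤ k<j) j<n)

  sweep-updated : ∀ x k → k ≤ m → ∀ j → j < k → at (sweep fs k x) j ≡ B j xor (S x xor at x (suc j))
  sweep-updated x (suc k) k<m j j<1+k with m<1+n⇒m<n∨m≡n j<1+k
  ... | inj₁ j<k  = trans (at-localUpdate-≢ fs k (sweep fs k x) j (≤-trans j<1+k (s≤s (<⇒≤ k<m))) (<⇒≢ j<k))
                          (sweep-updated x k (<⇒≤ k<m) j j<k)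
  ... | inj₂ refl = begin
    at (localUpdate fs j Y) j                                   ≡⟨ at-localUpdate-≡ fs j Y (≤-trans k<m (n≤1+n m)) ⟩
    eval (fnAt fs j) (at Y (j + m)) (at Y j) (at Y (j + 1))     ≡⟨ eval-≡-bit-xor (fnAt fs j) _ _ _ ⟩
    b j xor (at Y (j + m) xor (at Y j xor at Y (j + 1)))        ≡⟨ cong₂ (λ l r → b j xor (l xor r)) (left j k<m)
                                                                     (cong₂ _xor_ middle right) ⟩
    b j xor (left-value j xor (at x j xor at x (suc j)))        ≡⟨ new-value j ⟩
    B j xor (S x xor at x (suc j))                              ∎
    where
    open ≡-Reasoning
    Y : State (suc m)
    Y = sweep fs j x
    middle : at Y j ≡ at x j
    middle = sweep-unchanged x j j ≤-refl (≤-trans k<m (n≤1+n m))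
    right : at Y (j + 1) ≡ at x (suc j)
    right = trans (cong (at Y) (+-comm j 1)) (sweep-unchanged x j (suc j) (n≤1+n j) (s≤s k<m))
    left-value : ℕ → Bool
    left-value zero    = at x m
    left-value (suc i) = B i xor (S x xor at x (suc i))
    left : ∀ i → suc i ≤ m → at (sweep fs i x) (i + m) ≡ left-value i
    left zero    _   = refl
    left (suc i) i<m = trans (cong (at (sweep fs (suc i) x)) (sym (+-suc i m)))
      (trans (at-periodic (sweep fs (suc i) x) i) (sweep-updated x (suc i) (<⇒≤ i<m) i ≤-refl))
    new-value : ∀ i → b i xor (left-value i xor (at x i xor at x (suc i))) ≡ B i xor (S x xor at x (suc i))
    new-value zero    = solve 4 (λ b₀ x₀ x₁ xₘ → b₀ :+ (xₘ :+ (x₀ :+ x₁)) := b₀ :+ ((x₀ :+ xₘ) :+ x₁))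
                              refl (b 0) (at x 0) (at x 1) (at x m)
    new-value (suc i) = solve 5 (λ Bᵢ bᵢ s xᵢ xᵢ₊₁ → bᵢ :+ ((Bᵢ :+ (s :+ xᵢ)) :+ (xᵢ :+ xᵢ₊₁))
                                                    := (Bᵢ :+ bᵢ) :+ (s :+ xᵢ₊₁))
                              refl (B i) (b (suc i)) (S x) (at x (suc i)) (at x (suc (suc i)))

  SDS-below : ∀ x j → j < m → at (SDS fs x) j ≡ B j xor (S x xor at x (suc j))
  SDS-below x j j<m = trans (at-localUpdate-≢ fs m (sweep fs m x) j (≤-trans j<m (n≤1+n m)) (<⇒≢ j<m))
                            (sweep-updated x m ≤-refl j j<m)

module NormalForm {m′} (fs : Vec LocalFn (suc (suc m′))) where

  m : ℕ
  m = suc m′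

  open Sweep fs public

  T : State (suc m) → State (suc m)
  T = SDS fs

  β : Bool
  β = B m

  τ : Bool
  τ = odd m′

  SDS-top : ∀ x → at (T x) m ≡ β xor (b 0 xor at x 1)
  SDS-top x = begin
    at (localUpdate fs m Y) m                                ≡⟨ at-localUpdate-≡ fs m Y ≤-refl ⟩
    eval (fnAt fs m) (at Y (m + m)) (at Y m) (at Y (m + 1))  ≡⟨ eval-≡-bit-xor (fnAt fs m) _ _ _ ⟩
    b m xor (at Y (m + m) xor (at Y m xor at Y (m + 1)))     ≡⟨ cong₂ (λ l r → b m xor (l xor r)) left
                                                                  (cong₂ _xor_ middle right) ⟩
    b m xor ((B m′ xor (S x xor at x m)) xor (at x m xor (b 0 xor (S x xor at x 1))))
      ≡⟨ solve 6 (λ bₘ Bₘ′ s xₘ b₀ x₁ → bₘ :+ ((Bₘ′ :+ (s :+ xₘ)) :+ (xₘ :+ (b₀ :+ (s :+ x₁))))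
                                          := (Bₘ′ :+ bₘ) :+ (b₀ :+ x₁))
                 refl (b m) (B m′) (S x) (at x m) (b 0) (at x 1) ⟩
    β xor (b 0 xor at x 1)                                   ∎
    where
    open ≡-Reasoning
    Y : State (suc m)
    Y = sweep fs m x
    left : at Y (m + m) ≡ B m′ xor (S x xor at x m)
    left = trans (cong (at Y) (sym (+-suc m′ m)))
                 (trans (at-periodic Y m′) (sweep-updated x m ≤-refl m′ ≤-refl))
    middle : at Y m ≡ at x m
    middle = sweep-unchanged x m m ≤-refl ≤-refl
    right : at Y (m + 1) ≡ b 0 xor (S x xor at x 1)
    right = trans (cong (at Y) (+-comm m 1))
                  (trans (at-periodic Y 0) (sweep-updated x m ≤-refl 0 (s≤s z≤n)))

  S-T : ∀ x → S (T x) ≡ S x xor β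
  S-T x = begin
    at (T x) 0 xor at (T x) m
      ≡⟨ cong₂ _xor_ (SDS-below x 0 (s≤s z≤n)) (SDS-top x) ⟩
    (b 0 xor (S x xor at x 1)) xor (β xor (b 0 xor at x 1))
      ≡⟨ solve 4 (λ b₀ s x₁ β → (b₀ :+ (s :+ x₁)) :+ (β :+ (b₀ :+ x₁)) := s :+ β) refl (b 0) (S x) (at x 1) β ⟩
    S x xor β ∎
    where open ≡-Reasoning

  -- The correction terms h and K are chosen so that T acts on the coordinates Z as a shift register.
  h : ℕ → Bool
  h zero    = false
  h (suc j) = h j xor (B (suc j) xor (β ∧ odd j))

  K : Bool
  K = (β xor b 0) xor ((β ∧ τ) xor h m′)

  Z : State (suc m) → ℕ → Bool
  Z x j = at x (suc j) xor ((S x ∧ odd j) xor h j)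

  Z-T : ∀ x j → j < m′ → Z (T x) j ≡ Z x (suc j)
  Z-T x j j<m′ = begin
    Z (T x) j
      ≡⟨ cong₂ (λ y s → y xor ((s ∧ odd j) xor h j)) (SDS-below x (suc j) (s≤s j<m′)) (S-T x) ⟩
    (B (suc j) xor (S x xor at x (suc (suc j)))) xor (((S x xor β) ∧ odd j) xor h j)
      ≡⟨ solve 6 (λ Bⱼ₊₁ s xⱼ₊₂ β p hⱼ →
                   (Bⱼ₊₁ :+ (s :+ xⱼ₊₂)) :+ (((s :+ β) :* p) :+ hⱼ)
                   := xⱼ₊₂ :+ ((s :* (con true :+ p)) :+ (hⱼ :+ (Bⱼ₊₁ :+ (β :* p)))))
               refl (B (suc j)) (S x) (at x (suc (suc j))) β (odd j) (h j) ⟩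
    Z x (suc j) ∎
    where open ≡-Reasoning

  Z-T-last : ∀ x → Z (T x) m′ ≡ Z x 0 xor ((τ ∧ S x) xor K)
  Z-T-last x = begin
    Z (T x) m′
      ≡⟨ cong₂ (λ y s → y xor ((s ∧ τ) xor h m′)) (SDS-top x) (S-T x) ⟩
    (β xor (b 0 xor at x 1)) xor (((S x xor β) ∧ τ) xor h m′)
      ≡⟨ solve 6 (λ β b₀ x₁ s τ hₘ′ →
                   (β :+ (b₀ :+ x₁)) :+ (((s :+ β) :* τ) :+ hₘ′)
                   := (x₁ :+ ((s :* con false) :+ con false)) :+ ((τ :* s) :+ ((β :+ b₀) :+ ((β :* τ) :+ hₘ′))))
               refl β (b 0) (at x 1) (S x) τ (h m′) ⟩
    Z x 0 xor ((τ ∧ S x) xor K) ∎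
    where open ≡-Reasoning

  S-iter : ∀ x t → S (iter t T x) ≡ S x xor (β ∧ odd t)
  S-iter x zero    = solve 2 (λ s β → s := s :+ (β :* con false)) refl (S x) β
  S-iter x (suc t) = begin
    S (T (iter t T x))                 ≡⟨ S-T (iter t T x) ⟩
    S (iter t T x) xor β               ≡⟨ cong (_xor β) (S-iter x t) ⟩
    (S x xor (β ∧ odd t)) xor β        ≡⟨ solve 3 (λ s β p → (s :+ (β :* p)) :+ β := s :+ (β :* (con true :+ p)))
                                                refl (S x) β (odd t) ⟩
    S x xor (β ∧ odd (suc t))          ∎
    where open ≡-Reasoning

  W : State (suc m) → ℕ → Bool
  W x t = Z (iter t T x) 0

  Z-iter : ∀ x t j → j < m → Z (iter t T x) j ≡ W x (t + j)
  Z-iter x t zero    _          = cong (W x) (sym (+-identityʳ t))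
  Z-iter x t (suc j) (s≤s j<m′) = begin
    Z (iter t T x) (suc j)   ≡⟨ Z-T (iter t T x) j j<m′ ⟨
    Z (iter (suc t) T x) j   ≡⟨ Z-iter x (suc t) j (≤-trans (n≤1+n _) (s≤s j<m′)) ⟩
    W x (suc t + j)          ≡⟨ cong (W x) (+-suc t j) ⟨
    W x (t + suc j)          ∎
    where open ≡-Reasoning

  e : Bool → ℕ → Bool
  e s t = (τ ∧ (s xor (β ∧ odd t))) xor K

  W-isSolution : ∀ x → IsSolution m (e (S x)) (W x)
  W-isSolution x t = begin
    W x (t + m)                                ≡⟨ cong (W x) (+-suc t m′) ⟩
    W x (suc t + m′)                           ≡⟨ Z-iter x (suc t) m′ ≤-refl ⟨
    Z (T (iter t T x)) m′                      ≡⟨ Z-T-last (iter t T x) ⟩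
    W x t xor ((τ ∧ S (iter t T x)) xor K)     ≡⟨ cong (λ s → W x t xor ((τ ∧ s) xor K)) (S-iter x t) ⟩
    W x t xor e (S x) t                        ∎
    where open ≡-Reasoning

  ≡-from-S-Z : ∀ {x y} → S x ≡ S y → (∀ j → j < m → Z x j ≡ Z y j) → x ≡ y
  ≡-from-S-Z {x} {y} Sx≡Sy Zx≗Zy = at-injective coordinates
    where
    above-0 : ∀ j → j < m → at x (suc j) ≡ at y (suc j)
    above-0 j j<m = begin
      at x (suc j)                                 ≡⟨ solve 2 (λ a c → a := (a :+ c) :+ c) refl (at x (suc j)) _ ⟩
      Z x j xor ((S x ∧ odd j) xor h j)            ≡⟨ cong₂ (λ z s → z xor ((s ∧ odd j) xor h j)) (Zx≗Zy j j<m) Sx≡Sy ⟩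
      Z y j xor ((S y ∧ odd j) xor h j)            ≡⟨ solve 2 (λ a c → (a :+ c) :+ c := a) refl (at y (suc j)) _ ⟩
      at y (suc j)                                 ∎
      where open ≡-Reasoning
    coordinates : ∀ i → i < suc m → at x i ≡ at y i
    coordinates zero    _       = begin
      at x 0                      ≡⟨ solve 2 (λ a c → a := (a :+ c) :+ c) refl (at x 0) (at x m) ⟩
      S x xor at x m              ≡⟨ cong₂ _xor_ Sx≡Sy (above-0 m′ ≤-refl) ⟩
      S y xor at y m              ≡⟨ solve 2 (λ a c → (a :+ c) :+ c := a) refl (at y 0) (at y m) ⟩
      at y 0                      ∎
      where open ≡-Reasoning
    coordinates (suc j) (s≤s j<m) = above-0 j j<m

  build-coordinate : Bool → (ℕ → Bool) → ℕ → Bool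
  build-coordinate s w zero    = s xor build-coordinate s w m
  build-coordinate s w (suc j) = w j xor ((s ∧ odd j) xor h j)

  build : Bool → (ℕ → Bool) → State (suc m)
  build s w = tabulate (λ i → build-coordinate s w (toℕ i))

  S-build : ∀ s w → S (build s w) ≡ s
  S-build s w = begin
    at (build s w) 0 xor at (build s w) m      ≡⟨ cong₂ _xor_ (at-tabulate {m} (build-coordinate s w) 0 (s≤s z≤n))
                                                              (at-tabulate {m} (build-coordinate s w) m ≤-refl) ⟩
    (s xor build-coordinate s w m) xor build-coordinate s w m
                                               ≡⟨ solve 2 (λ s c → (s :+ c) :+ c := s) refl s _ ⟩
    s                                          ∎
    where open ≡-Reasoning

  Z-build : ∀ s w j → j < m → Z (build s w) j ≡ w j
  Z-build s w j j<m = begin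
    Z (build s w) j
      ≡⟨ cong₂ (λ y s → y xor ((s ∧ odd j) xor h j))
               (at-tabulate {m} (build-coordinate s w) (suc j) (s≤s j<m)) (S-build s w) ⟩
    (w j xor ((s ∧ odd j) xor h j)) xor ((s ∧ odd j) xor h j)
      ≡⟨ solve 2 (λ a c → (a :+ c) :+ c := a) refl (w j) _ ⟩
    w j ∎
    where open ≡-Reasoning

  W-build : ∀ s w → IsSolution m (e s) w → ∀ t → W (build s w) t ≡ w t
  W-build s w w-sol = solution-unique m (e s) W-sol w-sol
    (λ j j<m → trans (sym (Z-iter (build s w) 0 j j<m)) (Z-build s w j j<m))
    where
    W-sol : IsSolution m (e s) (W (build s w))
    W-sol = subst (λ s′ → IsSolution m (e s′) (W (build s w))) (S-build s w) (W-isSolution (build s w))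

  fixed⇒β∧odd : ∀ {r x} → iter r T x ≡ x → β ∧ odd r ≡ false
  fixed⇒β∧odd {r} {x} fixed = xor-≡-self⇒false (S x) _ (trans (sym (S-iter x r)) (cong S fixed))

  fixed⇒periodic : ∀ {r x} → iter r T x ≡ x → Periodic r (W x)
  fixed⇒periodic {r} {x} fixed t = cong (λ y → Z y 0) (trans (iter-+ T t r x) (cong (iter t T) fixed))

  periodic⇒fixed : ∀ {r x} → β ∧ odd r ≡ false → Periodic r (W x) → iter r T x ≡ x
  periodic⇒fixed {r} {x} β∧odd W-per = ≡-from-S-Z S-eq Z-eq
    where
    S-eq : S (iter r T x) ≡ S x
    S-eq = trans (S-iter x r) (trans (cong (S x xor_) β∧odd) (Bool.xor-identityʳ (S x)))
    Z-eq : ∀ j → j < m → Z (iter r T x) j ≡ Z x j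
    Z-eq j j<m = begin
      Z (iter r T x) j   ≡⟨ Z-iter x r j j<m ⟩
      W x (r + j)        ≡⟨ cong (W x) (+-comm r j) ⟩
      W x (j + r)        ≡⟨ W-per j ⟩
      W x j              ≡⟨ Z-iter x 0 j j<m ⟨
      Z x j              ∎
      where open ≡-Reasoning

  window : ∀ q → State (suc m) → State q
  window q x = tabulate (λ i → W x (toℕ i))

  -- A fixed point of Tʳ is recovered from S and the first q values of its W-stream; Compatible s
  -- says that conversely every stream solving the step-q recurrence is the W-stream of a fixed point.
  module Slices (r q′ : ℕ) (ε : Bool → ℕ → Bool) (β∧odd : β ∧ odd r ≡ false)
                (W-solves : ∀ x → iter r T x ≡ x → IsSolution (suc q′) (ε (S x)) (W x)) where

    q : ℕ
    q = suc q′

    Compatible : Bool → Set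
    Compatible s = ∀ w → IsSolution q (ε s) w → IsSolution m (e s) w × Periodic r w

    stream : Bool → State q → ℕ → Bool
    stream s p = solution q (ε s) (at p)

    stream-compatible : ∀ {s} → Compatible s → ∀ p → IsSolution m (e s) (stream s p) × Periodic r (stream s p)
    stream-compatible {s} compatible p = compatible (stream s p) (solution-isSolution q (ε s) (at p))

    embed : Bool → State q → State (suc m)
    embed s p = build s (stream s p)

    W-embed : ∀ {s} → Compatible s → ∀ p t → W (embed s p) t ≡ stream s p t
    W-embed {s} compatible p =
      W-build s (stream s p) (proj₁ (stream-compatible compatible p))

    embed-fixed : ∀ {s} → Compatible s → ∀ p → iter r T (embed s p) ≡ embed s p
    embed-fixed {s} compatible p = periodic⇒fixed β∧odd λ t → begin
      W (embed s p) (t + r)              ≡⟨ W-embed compatible p (t + r) ⟩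
      stream s p (t + r)    ≡⟨ proj₂ (stream-compatible compatible p) t ⟩
      stream s p t          ≡⟨ W-embed compatible p t ⟨
      W (embed s p) t                    ∎
      where open ≡-Reasoning

    window-embed : ∀ {s} → Compatible s → ∀ p → window q (embed s p) ≡ p
    window-embed {s} compatible p = trans (tabulate-cong W≗p) (tabulate∘lookup p)
      where
      W≗p : ∀ i → W (embed s p) (toℕ i) ≡ lookup p i
      W≗p i = begin
        W (embed s p) (toℕ i)             ≡⟨ W-embed compatible p (toℕ i) ⟩
        stream s p (toℕ i)   ≡⟨ solution-init q (ε s) (at p) (toℕ i) (toℕ<n i) ⟩
        at p (toℕ i)                      ≡⟨ at-lookup p i ⟩
        lookup p i                        ∎
        where open ≡-Reasoning

    embed-window : ∀ x → iter r T x ≡ x → embed (S x) (window q x) ≡ x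
    embed-window x fixed = ≡-from-S-Z (S-build (S x) w) λ j j<m → begin
      Z (embed (S x) (window q x)) j  ≡⟨ Z-build (S x) w j j<m ⟩
      w j                             ≡⟨ w≗W j ⟩
      W x j                           ≡⟨ Z-iter x 0 j j<m ⟨
      Z x j                           ∎
      where
      open ≡-Reasoning
      w : ℕ → Bool
      w = solution q (ε (S x)) (at (window q x))
      w≗W : ∀ t → w t ≡ W x t
      w≗W = solution-unique q (ε (S x)) (solution-isSolution q (ε (S x)) _) (W-solves x fixed)
        (λ j j<q → trans (solution-init q (ε (S x)) _ j j<q) (at-tabulate (W x) j j<q))

    numFixed-one-slice : ∀ s → Compatible s → (∀ x → iter r T x ≡ x → S x ≡ s) → numFixed (iter r T) ≡ 2 ^ q
    numFixed-one-slice s compatible S≡s = numFixed-≡-2^ (iter r T) (embed s) (window q)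
      (embed-fixed compatible) (window-embed compatible)
      (λ x fixed → subst (λ s′ → embed s′ (window q x) ≡ x) (S≡s x fixed) (embed-window x fixed))

    numFixed-all-slices : (∀ s → Compatible s) → numFixed (iter r T) ≡ 2 ^ suc q
    numFixed-all-slices compatible = numFixed-≡-2^ (iter r T) to from
      (λ { (s ∷ p) → embed-fixed (compatible s) p })
      (λ { (s ∷ p) → cong₂ _∷_ (S-build s (stream s p)) (window-embed (compatible s) p) })
      (λ x fixed → embed-window x fixed)
      where
      to : State (suc q) → State (suc m)
      to (s ∷ p) = embed s p
      from : State (suc m) → State (suc q)
      from x = S x ∷ window q x

  e-when-β≡false : β ≡ false → ∀ s t → e s t ≡ (τ ∧ s) xor K
  e-when-β≡false β≡false s t = trans (cong (λ b → (τ ∧ (s xor (b ∧ odd t))) xor K) β≡false)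
                                     (cong (λ s′ → (τ ∧ s′) xor K) (Bool.xor-identityʳ s))

  module Divides (r′ c : ℕ) (m≡c*r : m ≡ c * suc r′) where

    r : ℕ
    r = suc r′

    fixed⇒solvable : ∀ {x} → iter r T x ≡ x → β ≡ false × (τ ∧ S x) xor K ≡ false
    fixed⇒solvable {x} fixed = β≡false , trans (sym (e-when-β≡false β≡false (S x) 0)) (e≡false 0)
      where
      e≡false : ∀ t → e (S x) t ≡ false
      e≡false t = xor-≡-self⇒false (W x t) _ (begin
        W x t xor e (S x) t   ≡⟨ W-isSolution x t ⟨
        W x (t + m)           ≡⟨ cong (λ k → W x (t + k)) m≡c*r ⟩
        W x (t + c * r)       ≡⟨ periodic-* (fixed⇒periodic fixed) c t ⟩
        W x t                 ∎)
        where open ≡-Reasoning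
      -- The forcing at t and t + 1 differs by β ∧ τ.
      β∧τ≡false : β ∧ τ ≡ false
      β∧τ≡false = begin
        β ∧ τ                       ≡⟨ solve 4 (λ β τ s K → β :* τ := ((τ :* (s :+ (β :* con false))) :+ K)
                                                                :+ ((τ :* (s :+ (β :* con true))) :+ K))
                                               refl β τ (S x) K ⟩
        e (S x) 0 xor e (S x) 1     ≡⟨ cong₂ _xor_ (e≡false 0) (e≡false 1) ⟩
        false                       ∎
        where open ≡-Reasoning
      -- β = true would force τ = odd r = false, contradicting odd m = not τ = odd c ∧ odd r.
      β≡false : β ≡ false
      β≡false = vanishes β τ (odd r) (odd c) β∧τ≡false (fixed⇒β∧odd {r} fixed)
                  (trans (cong odd m≡c*r) (odd-* c r))
        where
        vanishes : ∀ b t o-r o-c → b ∧ t ≡ false → b ∧ o-r ≡ false → not t ≡ o-c ∧ o-r → b ≡ false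
        vanishes false _     _     _     _ _ _  = refl
        vanishes true  false false false _ _ ()
        vanishes true  false false true  _ _ ()

    W-solves : ∀ x → iter r T x ≡ x → IsSolution r (λ _ → false) (W x)
    W-solves x fixed t = trans (fixed⇒periodic fixed t) (sym (Bool.xor-identityʳ (W x t)))

    module Periodic-Slices (β≡false : β ≡ false) =
      Slices r r′ (λ _ _ → false) (cong (_∧ odd r) β≡false) W-solves

    compatible : (β≡false : β ≡ false) → ∀ {s} → (τ ∧ s) xor K ≡ false → Periodic-Slices.Compatible β≡false s
    compatible β≡false {s} solvable w w-sol = w-sol-m , w-per
      where
      w-per : Periodic r w
      w-per t = trans (w-sol t) (Bool.xor-identityʳ (w t))
      w-sol-m : IsSolution m (e s) w
      w-sol-m t = begin
        w (t + m)         ≡⟨ cong (λ k → w (t + k)) m≡c*r ⟩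
        w (t + c * r)     ≡⟨ periodic-* w-per c t ⟩
        w t               ≡⟨ Bool.xor-identityʳ (w t) ⟨
        w t xor false     ≡⟨ cong (w t xor_) (trans (e-when-β≡false β≡false s t) solvable) ⟨
        w t xor e s t     ∎
        where open ≡-Reasoning

    numFixed-τ≡true : β ≡ false → τ ≡ true → numFixed (iter r T) ≡ 2 ^ r
    numFixed-τ≡true β≡false τ≡true = numFixed-one-slice K (compatible β≡false K-solvable) S≡K
      where
      open Periodic-Slices β≡false
      K-solvable : (τ ∧ K) xor K ≡ false
      K-solvable = trans (cong (λ t → (t ∧ K) xor K) τ≡true) (Bool.xor-same K)
      S≡K : ∀ x → iter r T x ≡ x → S x ≡ K
      S≡K x fixed = xor-≡-false⇒≡ (S x) K
        (trans (cong (λ t → (t ∧ S x) xor K) (sym τ≡true)) (proj₂ (fixed⇒solvable fixed)))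

    numFixed-τ≡false : β ≡ false → τ ≡ false → K ≡ false → numFixed (iter r T) ≡ 2 ^ suc r
    numFixed-τ≡false β≡false τ≡false K≡false =
      numFixed-all-slices (λ s → compatible β≡false (cong₂ (λ t k → (t ∧ s) xor k) τ≡false K≡false))
      where open Periodic-Slices β≡false

  Solvable : Set
  Solvable = β ≡ false × Σ Bool (λ s → (τ ∧ s) xor K ≡ false)

  hasFixedPoint⇒solvable : HasFixedPoint T → Solvable
  hasFixedPoint⇒solvable (x , fixed) = proj₁ solvable , S x , proj₂ solvable
    where
    solvable : β ≡ false × (τ ∧ S x) xor K ≡ false
    solvable = Divides.fixed⇒solvable 0 m (sym (*-identityʳ m)) fixed

  solvable⇒hasFixedPoint : Solvable → HasFixedPoint T
  solvable⇒hasFixedPoint (β≡false , s , solvable) =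
    embed s (false ∷ []) , embed-fixed {s} (compatible β≡false {s} solvable) (false ∷ [])
    where
    open Divides 0 m (sym (*-identityʳ m))
    open Periodic-Slices β≡false

  module Halves (q′ d : ℕ) (m≡q+d*r : m ≡ suc q′ + d * (suc q′ + suc q′))
                (τ∧odd-q : τ ∧ odd (suc q′) ≡ false) where

    q r : ℕ
    q = suc q′
    r = q + q

    e-periodic : ∀ s → Periodic q (e s)
    e-periodic s t = begin
      (τ ∧ (s xor (β ∧ odd (t + q)))) xor K          ≡⟨ cong (λ o → (τ ∧ (s xor (β ∧ o))) xor K) (odd-+ t q) ⟩
      (τ ∧ (s xor (β ∧ (odd t xor odd q)))) xor K    ≡⟨ solve 6 (λ τ s β o o-q K →
                                                           (τ :* (s :+ (β :* (o :+ o-q)))) :+ K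
                                                           := ((τ :* (s :+ (β :* o))) :+ K) :+ (β :* (τ :* o-q)))
                                                         refl τ s β (odd t) (odd q) K ⟩
      e s t xor (β ∧ (τ ∧ odd q))                    ≡⟨ cong (λ z → e s t xor (β ∧ z)) τ∧odd-q ⟩
      e s t xor (β ∧ false)                          ≡⟨ solve 2 (λ a β → a :+ (β :* con false) := a) refl (e s t) β ⟩
      e s t                                          ∎
      where open ≡-Reasoning

    W-solves : ∀ x → iter r T x ≡ x → IsSolution q (e (S x)) (W x)
    W-solves x fixed t = begin
      W x (t + q)            ≡⟨ periodic-* (fixed⇒periodic fixed) d (t + q) ⟨
      W x (t + q + d * r)    ≡⟨ cong (W x) (trans (+-assoc t q (d * r)) (cong (t +_) (sym m≡q+d*r))) ⟩
      W x (t + m)            ≡⟨ W-isSolution x t ⟩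
      W x t xor e (S x) t    ∎
      where open ≡-Reasoning

    β∧odd : β ∧ odd r ≡ false
    β∧odd = trans (cong (β ∧_) (odd-double q)) (Bool.∧-zeroʳ β)

    open Slices r q′ e β∧odd W-solves using (Compatible; numFixed-all-slices)

    compatible : ∀ s → Compatible s
    compatible s w w-sol = w-sol-m , w-per
      where
      w-per : Periodic r w
      w-per = solution-periodic w-sol (e-periodic s)
      w-sol-m : IsSolution m (e s) w
      w-sol-m t = begin
        w (t + m)                           ≡⟨ cong w (trans (cong (t +_) (trans m≡q+d*r (+-comm q (d * r))))
                                                             (sym (+-assoc t (d * r) q))) ⟩
        w (t + d * r + q)                   ≡⟨ w-sol (t + d * r) ⟩
        w (t + d * r) xor e s (t + d * r)   ≡⟨ cong₂ _xor_ (periodic-* w-per d t)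
                                                          (periodic-* (periodic-double (e-periodic s)) d t) ⟩
        w t xor e s t                       ∎
        where open ≡-Reasoning

    numFixed-halves : numFixed (iter r T) ≡ 2 ^ suc q
    numFixed-halves = numFixed-all-slices compatible

  numFixed-divides-τ≡false : ∀ {r′} → Solvable → τ ≡ false → suc r′ ∣ m →
                             numFixed (iter (suc r′) T) ≡ 2 ^ suc (suc r′)
  numFixed-divides-τ≡false {r′} (β≡false , s , solvable) τ≡false (divides c m≡c*r) =
    Divides.numFixed-τ≡false r′ c m≡c*r β≡false τ≡false
      (trans (cong (λ t → (t ∧ s) xor K) (sym τ≡false)) solvable)

  numFixed-divides-τ≡true : ∀ {r′} → Solvable → τ ≡ true → suc r′ ∣ m → numFixed (iter (suc r′) T) ≡ 2 ^ suc r′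
  numFixed-divides-τ≡true {r′} (β≡false , _) τ≡true (divides c m≡c*r) =
    Divides.numFixed-τ≡true r′ c m≡c*r β≡false τ≡true

  numFixed-divides-unsolvable : ∀ {r′} → ¬ Solvable → suc r′ ∣ m → numFixed (iter (suc r′) T) ≡ 0
  numFixed-divides-unsolvable {r′} unsolvable (divides c m≡c*r) = numFixed-≡-0 (iter (suc r′) T) λ x fixed →
    unsolvable (proj₁ (fixed⇒solvable fixed) , S x , proj₂ (fixed⇒solvable fixed))
    where open Divides r′ c m≡c*r

  numFixed-not-divides : ∀ {r′} → suc r′ ∣ m + m → ¬ suc r′ ∣ m →
                         numFixed (iter (suc r′) T) ≡ 2 ^ (suc r′ / 2 + 1)
  numFixed-not-divides {r′} r∣m+m r∤m = from-halving (halve-divisor r∣m+m r∤m)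
    where
    from-halving : (Σ ℕ λ q → Σ ℕ λ d → suc r′ ≡ q + q × m ≡ q + d * suc r′) →
                   numFixed (iter (suc r′) T) ≡ 2 ^ (suc r′ / 2 + 1)
    from-halving (suc q′ , d , r≡q+q , m≡q+d*r) = begin
        numFixed (iter (suc r′) T)   ≡⟨ cong (λ r → numFixed (iter r T)) r≡q+q ⟩
        numFixed (iter (q + q) T)    ≡⟨ Halves.numFixed-halves q′ d m≡q+d*[q+q] τ∧odd-q ⟩
        2 ^ suc q                    ≡⟨ cong (2 ^_) (trans (+-comm 1 q) (cong (_+ 1) (sym ([n+n]/2≡n q)))) ⟩
        2 ^ ((q + q) / 2 + 1)        ≡⟨ cong (λ r → 2 ^ (r / 2 + 1)) r≡q+q ⟨
        2 ^ (suc r′ / 2 + 1)         ∎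
        where
        open ≡-Reasoning
        q : ℕ
        q = suc q′
        m≡q+d*[q+q] : m ≡ q + d * (q + q)
        m≡q+d*[q+q] = subst (λ r → m ≡ q + d * r) r≡q+q m≡q+d*r
        -- odd m reduces to not τ.
        τ∧odd-q : τ ∧ odd q ≡ false
        τ∧odd-q = trans (cong (τ ∧_) (trans (sym (odd-+-*-double q d q)) (cong odd (sym m≡q+d*[q+q]))))
                        (Bool.∧-inverseʳ τ)

lemma4p8 : (n r : ℕ) → 3 ≤ n → 1 ≤ r → r ∣ (2 * n ∸ 2) → (fs : Vec LocalFn n) →
    (HasFixedPoint (SDS fs) →
        (r ∣ (n ∸ 1) → n % 2 ≡ 0 → numFixed (iter r (SDS fs)) ≡ 2 ^ (r + 1))
      × (r ∣ (n ∸ 1) → n % 2 ≡ 1 → numFixed (iter r (SDS fs)) ≡ 2 ^ r)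
      × (¬ (r ∣ (n ∸ 1)) → numFixed (iter r (SDS fs)) ≡ 2 ^ (r / 2 + 1)))
    × (¬ HasFixedPoint (SDS fs) →
        (r ∣ (n ∸ 1) → numFixed (iter r (SDS fs)) ≡ 0)
      × (¬ (r ∣ (n ∸ 1)) → numFixed (iter r (SDS fs)) ≡ 2 ^ (r / 2 + 1)))
lemma4p8 n@(suc (suc (suc _))) (suc r′) (s≤s (s≤s (s≤s _))) (s≤s _) r∣2n∸2 fs =
    (λ has-fixed →
        (λ r∣m n-even → trans (numFixed-divides-τ≡false {r′} (hasFixedPoint⇒solvable has-fixed) (τ≡ n-even) r∣m)
                              (cong (2 ^_) (+-comm 1 (suc r′))))
      , (λ r∣m n-odd → numFixed-divides-τ≡true {r′} (hasFixedPoint⇒solvable has-fixed) (τ≡ n-odd) r∣m)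
      , numFixed-not-divides {r′} r∣m+m)
  , (λ no-fixed →
        numFixed-divides-unsolvable {r′} (λ solvable → no-fixed (solvable⇒hasFixedPoint solvable))
      , numFixed-not-divides {r′} r∣m+m)
  where
  open NormalForm fs
  r∣m+m : suc r′ ∣ m + m
  r∣m+m = subst (suc r′ ∣_) (2*[1+m]∸2≡m+m m) r∣2n∸2
  τ≡ : ∀ {b} → n % 2 ≡ (if b then 1 else 0) → τ ≡ b
  τ≡ n%2 = trans (sym (Bool.not-involutive τ)) (odd-from-%2 n n%2)
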